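{- Let $N$ and $n$ be positive integers. Then $$ c_{N,n}=n!\,\det\left( \begin{array}{ccccc} \frac{N}{N+1}&1&&&\\ \frac{N}{N+2}&\frac{N}{N+1}&&&\\ \vdots&\vdots&\ddots&1&\\ \frac{N}{N+n-1}&\frac{N}{N+n-2}&\cdots&\frac{N}{N+1}&1\\ \frac{N}{N+n}&\frac{N}{N+n-1}&\cdots&\frac{N}{N+2}&\frac{N}{N+1} \end{array} \right), $$ i.e. $c_{N,n}=n!\det(m_{ij})_{1\le i,j\le n}$ where $m_{ij}=\frac{N}{N+i-j+1}$ for $j\le i$, $m_{i,i+1}=1$, and $m_{ij}=0$ for $j\ge i+2$.
   Context: For a positive integer $N$, the hypergeometric Cauchy numbers $c_{N,n}$ ($n\ge 0$) are defined by the formal power series identity $$\frac{1}{{}_2F_1(1,N;N+1;-x)}=\frac{(-1)^{N-1}x^N/N}{\log(1+x)-\sum_{k=1}^{N-1}(-1)^{k-1}x^k/k}=\sum_{n=0}^\infty c_{N,n}\frac{x^n}{n!},$$ where ${}_2F_1(a,b;c;z)=\sum_{n\ge0}\frac{(a)^{(n)}(b)^{(n)}}{(c)^{(n)}}\frac{z^n}{n!}$ is the Gauss hypergeometric function and $(x)^{(n)}=x(x+1)\cdots(x+n-1)$, $(x)^{(0)}=1$. In particular $c_{N,0}=1$. -}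

module Defs where

open import Data.Nat as ℕ using (ℕ; zero; suc; _!; _∸_; _≤?_; _≟_; NonZero)
open import Data.Nat.Properties using (m*n≢0; _!*_!≢0)
open import Data.Integer using (+_)
open import Data.Rational using (ℚ; 0ℚ; 1ℚ; _+_; _*_; -_; _/_)
open import Data.Fin using (Fin; toℕ; punchIn) renaming (zero to fzero; suc to fsuc)
open import Data.List using (List; []; _∷_)
open import Relation.Nullary using (yes; no)

rise : ℕ → ℕ → ℕ
rise x zero    = 1
rise x (suc n) = rise x n ℕ.* (x ℕ.+ n)

riseNZ : ∀ x n → NonZero (rise (suc x) n)
riseNZ x zero    = _
riseNZ x (suc n) = m*n≢0 (rise (suc x) n) (suc x ℕ.+ n) {{riseNZ x n}}

negOnePow : ℕ → ℚ
negOnePow zero    = 1ℚ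
negOnePow (suc n) = - negOnePow n

-- Coefficient of x^n in 2F1(1,N;N+1;-x):
--   (1)^(n) (N)^(n) / ((N+1)^(n) n!) * (-1)^n
hypCoeff : ℕ → ℕ → ℚ
hypCoeff N n =
  negOnePow n *
  ((+ (rise 1 n ℕ.* rise N n) / (rise (suc N) n ℕ.* n !))
     {{m*n≢0 (rise (suc N) n) (n !) {{riseNZ N n}} {{n !≢0}}}})
  where open import Data.Nat.Properties using (_!≢0)

-- Coefficients of the multiplicative inverse 1/A(x) of a formal power
-- series A(x) = Σ a_n x^n with constant term a_0 = 1 (as is the case for
-- 2F1(1,N;N+1;-x)): b_0 = 1, b_n = - Σ_{k=1}^{n} a_k b_{n-k}.
-- invRev a n is the list [b_n, b_{n-1}, ..., b_0].
convFrom : (ℕ → ℚ) → ℕ → List ℚ → ℚ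
convFrom a k []       = 0ℚ
convFrom a k (x ∷ xs) = a k * x + convFrom a (suc k) xs

invRev : (ℕ → ℚ) → ℕ → List ℚ
invRev a zero    = 1ℚ ∷ []
invRev a (suc n) = (- convFrom a 1 (invRev a n)) ∷ invRev a n

headQ : List ℚ → ℚ
headQ []      = 0ℚ
headQ (x ∷ _) = x

invCoeff : (ℕ → ℚ) → ℕ → ℚ
invCoeff a n = headQ (invRev a n)

-- Hypergeometric Cauchy numbers: 1/2F1(1,N;N+1;-x) = Σ c_{N,n} x^n / n!
c : ℕ → ℕ → ℚ
c N n = (+ (n !) / 1) * invCoeff (hypCoeff N) n

sumFin : (n : ℕ) → (Fin n → ℚ) → ℚ
sumFin zero    f = 0ℚ
sumFin (suc n) f = f fzero + sumFin n (λ i → f (fsuc i))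

det : (n : ℕ) → (Fin n → Fin n → ℚ) → ℚ
det zero    M = 1ℚ
det (suc n) M =
  sumFin (suc n) (λ j → negOnePow (toℕ j) * (M fzero j * det n (λ i k → M (fsuc i) (punchIn j k))))

-- The matrix (m_ij), with 0-based indices i, j : Fin n
-- (1-based: m_ij = N/(N+i-j+1) for j ≤ i, m_{i,i+1} = 1, m_ij = 0 for j ≥ i+2).
hcMatrix : (N n : ℕ) → Fin n → Fin n → ℚ
hcMatrix N n i j with toℕ j ≤? toℕ i
... | yes _ = + N / suc (N ℕ.+ (toℕ i ∸ toℕ j))
... | no  _ with toℕ j ≟ suc (toℕ i)
...   | yes _ = 1ℚ
...   | no  _ = 0ℚ

{-# OPTIONS --safe #-}
module Submission where

-- Let D_n(f) be the determinant of the n×n lower Hessenberg Toeplitz matrix with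
-- α(i−j) on and below the diagonal and 1 on the superdiagonal, but with its first
-- column replaced by f. Its first row is (f₀, 1, 0, …, 0), so Laplace expansion
-- gives D_{n+1}(f) = f₀ D_n(α) − D_n(f ∘ suc), hence D_n(f) = Σ_{k<n} (−1)ᵏ fₖ b_{n−1−k}
-- with b_n = D_n(α). For α_k = N/(N+k+1) the (k+1)-st coefficient of ₂F₁(1,N;N+1;−x)
-- is (−1)^{k+1} α_k, so this is the recursion b_n = −Σ_{k≥1} a_k b_{n−k} of the
-- coefficients of the reciprocal series.

open import Defs
open import Data.Nat using (ℕ; _≤_; _!)
open import Data.Integer using (+_)
open import Data.Rational using (_*_; _/_)
open import Relation.Binary.PropositionalEquality using (_≡_)

open import Data.Nat as ℕ using (zero; suc; _∸_; NonZero; s≤s; z≤n)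
import Data.Nat.Properties as ℕ
open import Data.Nat.Tactic.RingSolver using (solve-∀)
import Data.Integer.Properties as ℤ
open import Data.Rational using (ℚ; 0ℚ; 1ℚ; _+_; _-_; -_)
open import Data.Rational.Properties using (*-zeroˡ; *-zeroʳ; *-identityˡ; fromℚᵘ-cong)
open import Data.Rational.Solver using (module +-*-Solver)
open import Data.Rational.Unnormalised using (mkℚᵘ; *≡*)
open import Data.Fin using (Fin; toℕ; punchIn) renaming (zero to fzero; suc to fsuc)
open import Data.List using (List; []; _∷_)
open import Function using (_∘_)
open import Relation.Nullary using (yes; no; ¬_)
open import Relation.Binary.PropositionalEquality
  using (refl; sym; trans; cong; cong₂; module ≡-Reasoning)

open +-*-Solver using (solve; _:=_; _:+_; _:-_; _:*_; :-_; con)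

sumFin-cong : ∀ n {f g : Fin n → ℚ} → (∀ i → f i ≡ g i) → sumFin n f ≡ sumFin n g
sumFin-cong zero    f≗g = refl
sumFin-cong (suc n) f≗g = cong₂ _+_ (f≗g fzero) (sumFin-cong n (f≗g ∘ fsuc))

sumFin-zero : ∀ n {f : Fin n → ℚ} → (∀ i → f i ≡ 0ℚ) → sumFin n f ≡ 0ℚ
sumFin-zero zero    f≗0 = refl
sumFin-zero (suc n) f≗0 = cong₂ _+_ (f≗0 fzero) (sumFin-zero n (f≗0 ∘ fsuc))

det-cong : ∀ n {M M′ : Fin n → Fin n → ℚ} → (∀ i j → M i j ≡ M′ i j) → det n M ≡ det n M′
det-cong zero    M≗M′ = refl
det-cong (suc n) M≗M′ = sumFin-cong (suc n) λ j →
  cong (negOnePow (toℕ j) *_)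
    (cong₂ _*_ (M≗M′ fzero j) (det-cong n λ i k → M≗M′ (fsuc i) (punchIn j k)))

det-expand-firstRow₂ : ∀ m (M : Fin (suc (suc m)) → Fin (suc (suc m)) → ℚ) →
  (∀ j → M fzero (fsuc (fsuc j)) ≡ 0ℚ) →
  det (suc (suc m)) M ≡
    M fzero fzero * det (suc m) (λ i k → M (fsuc i) (fsuc k))
    - M fzero (fsuc fzero) * det (suc m) (λ i k → M (fsuc i) (punchIn (fsuc fzero) k))
det-expand-firstRow₂ m M row₀≡0 = begin
  1ℚ * (x * d₀) + (- 1ℚ * (y * d₁) + rest) ≡⟨ cong (λ r → 1ℚ * (x * d₀) + (- 1ℚ * (y * d₁) + r)) rest≡0 ⟩
  1ℚ * (x * d₀) + (- 1ℚ * (y * d₁) + 0ℚ)   ≡⟨ solve 4 (λ x d₀ y d₁ →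
                                                  con 1ℚ :* (x :* d₀) :+ (:- con 1ℚ :* (y :* d₁) :+ con 0ℚ)
                                                  := x :* d₀ :- y :* d₁) refl x d₀ y d₁ ⟩
  x * d₀ - y * d₁                           ∎
  where
  open ≡-Reasoning
  x = M fzero fzero
  y = M fzero (fsuc fzero)
  d₀ = det (suc m) (λ i k → M (fsuc i) (fsuc k))
  d₁ = det (suc m) (λ i k → M (fsuc i) (punchIn (fsuc fzero) k))
  minor : Fin m → ℚ
  minor j = det (suc m) (λ i k → M (fsuc i) (punchIn (fsuc (fsuc j)) k))
  rest = sumFin m (λ j → negOnePow (toℕ (fsuc (fsuc j))) * (M fzero (fsuc (fsuc j)) * minor j))
  rest≡0 : rest ≡ 0ℚ
  rest≡0 = sumFin-zero m λ j → begin
    negOnePow (suc (suc (toℕ j))) * (M fzero (fsuc (fsuc j)) * minor j)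
      ≡⟨ cong (λ e → negOnePow (suc (suc (toℕ j))) * (e * minor j)) (row₀≡0 j) ⟩
    negOnePow (suc (suc (toℕ j))) * (0ℚ * minor j)
      ≡⟨ cong (negOnePow (suc (suc (toℕ j))) *_) (*-zeroˡ (minor j)) ⟩
    negOnePow (suc (suc (toℕ j))) * 0ℚ
      ≡⟨ *-zeroʳ (negOnePow (suc (suc (toℕ j)))) ⟩
    0ℚ ∎

leading : (n : ℕ) → (ℕ → ℕ → ℚ) → Fin n → Fin n → ℚ
leading n M i j = M (toℕ i) (toℕ j)

toeplitzHessenberg : (ℕ → ℚ) → ℕ → ℕ → ℚ
toeplitzHessenberg α i       zero          = α i
toeplitzHessenberg α zero    (suc zero)    = 1ℚ
toeplitzHessenberg α zero    (suc (suc j)) = 0ℚ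
toeplitzHessenberg α (suc i) (suc j)       = toeplitzHessenberg α i j

toeplitzHessenberg-≤ : ∀ α {i j} → j ≤ i → toeplitzHessenberg α i j ≡ α (i ∸ j)
toeplitzHessenberg-≤ α {i}     {zero}  _         = refl
toeplitzHessenberg-≤ α {suc i} {suc j} (s≤s j≤i) = toeplitzHessenberg-≤ α j≤i

toeplitzHessenberg-super : ∀ α i → toeplitzHessenberg α i (suc i) ≡ 1ℚ
toeplitzHessenberg-super α zero    = refl
toeplitzHessenberg-super α (suc i) = toeplitzHessenberg-super α i

toeplitzHessenberg-above : ∀ α {i j} → ¬ j ≤ i → ¬ j ≡ suc i → toeplitzHessenberg α i j ≡ 0ℚ
toeplitzHessenberg-above α {i}     {zero}        j≰i _ with () ← j≰i z≤n
toeplitzHessenberg-above α {zero}  {suc zero}    _ j≢1 with () ← j≢1 refl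
toeplitzHessenberg-above α {zero}  {suc (suc j)} _ _ = refl
toeplitzHessenberg-above α {suc i} {suc j}       j≰i j≢i+2 =
  toeplitzHessenberg-above α (j≰i ∘ s≤s) (j≢i+2 ∘ cong suc)

replaceColumn₀ : (ℕ → ℚ) → (ℕ → ℕ → ℚ) → ℕ → ℕ → ℚ
replaceColumn₀ f M i zero    = f i
replaceColumn₀ f M i (suc j) = M i (suc j)

hessenbergDet : (ℕ → ℚ) → (ℕ → ℚ) → ℕ → ℚ
hessenbergDet α f n = det n (leading n (replaceColumn₀ f (toeplitzHessenberg α)))

hessenbergDet-suc : ∀ α f m →
  hessenbergDet α f (suc (suc m)) ≡ f 0 * hessenbergDet α α (suc m) - hessenbergDet α (f ∘ suc) (suc m)
hessenbergDet-suc α f m = begin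
  hessenbergDet α f (suc (suc m))       ≡⟨ det-expand-firstRow₂ m M (λ _ → refl) ⟩
  f 0 * d₀ - 1ℚ * d₁                    ≡⟨ cong₂ (λ u v → f 0 * u - v) minor₀₀ (trans (*-identityˡ d₁) minor₀₁) ⟩
  f 0 * hessenbergDet α α (suc m) - hessenbergDet α (f ∘ suc) (suc m) ∎
  where
  open ≡-Reasoning
  M = leading (suc (suc m)) (replaceColumn₀ f (toeplitzHessenberg α))
  d₀ = det (suc m) (λ i k → M (fsuc i) (fsuc k))
  d₁ = det (suc m) (λ i k → M (fsuc i) (punchIn (fsuc fzero) k))
  minor₀₀ : d₀ ≡ hessenbergDet α α (suc m)
  minor₀₀ = det-cong (suc m) {M = λ i k → M (fsuc i) (fsuc k)}
                              {M′ = leading (suc m) (replaceColumn₀ α (toeplitzHessenberg α))} λ where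
    i fzero    → refl
    i (fsuc k) → refl
  minor₀₁ : d₁ ≡ hessenbergDet α (f ∘ suc) (suc m)
  minor₀₁ = det-cong (suc m) {M = λ i k → M (fsuc i) (punchIn (fsuc fzero) k)}
                              {M′ = leading (suc m) (replaceColumn₀ (f ∘ suc) (toeplitzHessenberg α))} λ where
    i fzero    → refl
    i (fsuc k) → refl

signedDot : (ℕ → ℚ) → List ℚ → ℚ
signedDot f []       = 0ℚ
signedDot f (x ∷ xs) = f 0 * x - signedDot (f ∘ suc) xs

signedDot-cong : ∀ {f g} → (∀ i → f i ≡ g i) → ∀ xs → signedDot f xs ≡ signedDot g xs
signedDot-cong f≗g []       = refl
signedDot-cong f≗g (x ∷ xs) =
  cong₂ (λ u v → u * x - v) (f≗g 0) (signedDot-cong (f≗g ∘ suc) xs)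

module _ {a α : ℕ → ℚ} (a≡ : ∀ k → a (suc k) ≡ negOnePow (suc k) * α k) where

  neg-convFrom≡signedDot : ∀ k xs →
    - convFrom a (suc k) xs ≡ negOnePow k * signedDot (λ i → α (k ℕ.+ i)) xs
  neg-convFrom≡signedDot k []       = sym (*-zeroʳ (negOnePow k))
  neg-convFrom≡signedDot k (x ∷ xs) = begin
    - (a (suc k) * x + convFrom a (suc (suc k)) xs)
      ≡⟨ cong₂ (λ u v → - (u * x + v)) (a≡ k) (double-neg _) ⟩
    - (- s * α k * x + - - convFrom a (suc (suc k)) xs)
      ≡⟨ cong (λ v → - (- s * α k * x + - v)) (neg-convFrom≡signedDot (suc k) xs) ⟩
    - (- s * α k * x + - (- s * t))
      ≡⟨ solve 4 (λ s a x t → :- (:- s :* a :* x :+ :- (:- s :* t)) := s :* (a :* x :- t)) refl s (α k) x t ⟩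
    s * (α k * x - t)
      ≡⟨ cong₂ (λ u v → s * (α u * x - v)) (sym (ℕ.+-identityʳ k))
           (signedDot-cong (λ i → cong α (sym (ℕ.+-suc k i))) xs) ⟩
    s * (α (k ℕ.+ 0) * x - signedDot (λ i → α (k ℕ.+ suc i)) xs) ∎
    where
    open ≡-Reasoning
    s = negOnePow k
    t = signedDot (λ i → α (suc k ℕ.+ i)) xs
    double-neg : ∀ p → p ≡ - - p
    double-neg = solve 1 (λ p → p := :- :- p) refl

  invCoeff≡signedDot : ∀ m → invCoeff a (suc m) ≡ signedDot α (invRev a m)
  invCoeff≡signedDot m = trans (neg-convFrom≡signedDot 0 (invRev a m)) (*-identityˡ _)

  hessenbergDet≡signedDot : ∀ m f → hessenbergDet α f (suc m) ≡ signedDot f (invRev a m)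
  hessenbergDet≡signedDot zero    f = solve 1 (λ y →
    con 1ℚ :* (y :* con 1ℚ) :+ con 0ℚ := y :* con 1ℚ :- con 0ℚ) refl (f 0)
  hessenbergDet≡signedDot (suc m) f = begin
    hessenbergDet α f (suc (suc m))
      ≡⟨ hessenbergDet-suc α f m ⟩
    f 0 * hessenbergDet α α (suc m) - hessenbergDet α (f ∘ suc) (suc m)
      ≡⟨ cong₂ (λ u v → f 0 * u - v) (hessenbergDet≡signedDot m α) (hessenbergDet≡signedDot m (f ∘ suc)) ⟩
    f 0 * signedDot α (invRev a m) - signedDot (f ∘ suc) (invRev a m)
      ≡⟨ cong (λ u → f 0 * u - signedDot (f ∘ suc) (invRev a m)) (sym (invCoeff≡signedDot m)) ⟩
    signedDot f (invRev a (suc m)) ∎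
    where open ≡-Reasoning

  invCoeff≡det-toeplitzHessenberg : ∀ m →
    invCoeff a (suc m) ≡ det (suc m) (leading (suc m) (toeplitzHessenberg α))
  invCoeff≡det-toeplitzHessenberg m = begin
    invCoeff a (suc m)              ≡⟨ invCoeff≡signedDot m ⟩
    signedDot α (invRev a m)        ≡⟨ sym (hessenbergDet≡signedDot m α) ⟩
    hessenbergDet α α (suc m)       ≡⟨ det-cong (suc m) (λ i j → column₀-unchanged (toℕ i) (toℕ j)) ⟩
    det (suc m) (leading (suc m) (toeplitzHessenberg α)) ∎
    where
    open ≡-Reasoning
    column₀-unchanged : ∀ i j → replaceColumn₀ α (toeplitzHessenberg α) i j ≡ toeplitzHessenberg α i j
    column₀-unchanged i zero    = refl
    column₀-unchanged i (suc j) = refl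

rise-1 : ∀ n → rise 1 n ≡ n !
rise-1 zero    = refl
rise-1 (suc n) = trans (cong (ℕ._* suc n) (rise-1 n)) (ℕ.*-comm (n !) (suc n))

rise-suc : ∀ x k → rise x (suc k) ≡ x ℕ.* rise (suc x) k
rise-suc x zero    = trans (ℕ.+-identityʳ (x ℕ.+ 0)) (trans (ℕ.+-identityʳ x) (sym (ℕ.*-identityʳ x)))
rise-suc x (suc k) = begin
  rise x (suc k) ℕ.* (x ℕ.+ suc k)            ≡⟨ cong₂ ℕ._*_ (rise-suc x k) (ℕ.+-suc x k) ⟩
  x ℕ.* rise (suc x) k ℕ.* suc (x ℕ.+ k)     ≡⟨ ℕ.*-assoc x (rise (suc x) k) (suc (x ℕ.+ k)) ⟩
  x ℕ.* rise (suc x) (suc k)                  ∎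
  where open ≡-Reasoning

/-cross-cong : ∀ p q r s .{{_ : NonZero q}} .{{_ : NonZero s}} →
  p ℕ.* s ≡ r ℕ.* q → + p / q ≡ + r / s
/-cross-cong p (suc q) r (suc s) ps≡rq = fromℚᵘ-cong {mkℚᵘ (+ p) q} {mkℚᵘ (+ r) s}
  (*≡* (trans (sym (ℤ.pos-* p (suc s))) (trans (cong +_ ps≡rq) (ℤ.pos-* r (suc q)))))

hcEntry : ℕ → ℕ → ℚ
hcEntry N d = + N / suc (N ℕ.+ d)

hypCoeff-suc : ∀ N k → hypCoeff N (suc k) ≡ negOnePow (suc k) * hcEntry N k
hypCoeff-suc N k = cong (negOnePow (suc k) *_)
  (/-cross-cong (rise 1 (suc k) ℕ.* rise N (suc k)) (rise (suc N) (suc k) ℕ.* suc k !) N (suc (N ℕ.+ k))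
    {{ℕ.m*n≢0 (rise (suc N) (suc k)) (suc k !) {{riseNZ N (suc k)}} {{ℕ._!≢0 (suc k)}}}} cross)
  where
  cross : rise 1 (suc k) ℕ.* rise N (suc k) ℕ.* suc (N ℕ.+ k) ≡ N ℕ.* (rise (suc N) (suc k) ℕ.* suc k !)
  cross = begin
    rise 1 (suc k) ℕ.* rise N (suc k) ℕ.* suc (N ℕ.+ k)
      ≡⟨ cong (ℕ._* suc (N ℕ.+ k)) (cong₂ ℕ._*_ (rise-1 (suc k)) (rise-suc N k)) ⟩
    suc k ! ℕ.* (N ℕ.* rise (suc N) k) ℕ.* suc (N ℕ.+ k)
      ≡⟨ rearrange (suc k !) N (rise (suc N) k) (suc (N ℕ.+ k)) ⟩
    N ℕ.* (rise (suc N) (suc k) ℕ.* suc k !) ∎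
    where
    open ≡-Reasoning
    rearrange : ∀ f n r s → f ℕ.* (n ℕ.* r) ℕ.* s ≡ n ℕ.* (r ℕ.* s ℕ.* f)
    rearrange = solve-∀

hcMatrix≡toeplitzHessenberg : ∀ N n i j → hcMatrix N n i j ≡ leading n (toeplitzHessenberg (hcEntry N)) i j
hcMatrix≡toeplitzHessenberg N n i j with toℕ j ℕ.≤? toℕ i
... | yes j≤i = sym (toeplitzHessenberg-≤ (hcEntry N) j≤i)
... | no  j≰i with toℕ j ℕ.≟ suc (toℕ i)
...   | yes j≡i+1 = sym (trans (cong (toeplitzHessenberg (hcEntry N) (toℕ i)) j≡i+1)
                               (toeplitzHessenberg-super (hcEntry N) (toℕ i)))
...   | no  j≢i+1 = sym (toeplitzHessenberg-above (hcEntry N) j≰i j≢i+1)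

theorem1 : (N n : ℕ) → 1 ≤ N → 1 ≤ n →
    c N n ≡ (+ (n !) / 1) * det n (hcMatrix N n)
theorem1 N (suc m) _ _ = cong ((+ (suc m !) / 1) *_) (begin
  invCoeff (hypCoeff N) (suc m)
    ≡⟨ invCoeff≡det-toeplitzHessenberg (hypCoeff-suc N) m ⟩
  det (suc m) (leading (suc m) (toeplitzHessenberg (hcEntry N)))
    ≡⟨ det-cong (suc m) (λ i j → sym (hcMatrix≡toeplitzHessenberg N (suc m) i j)) ⟩
  det (suc m) (hcMatrix N (suc m)) ∎)
  where open ≡-Reasoning
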